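{- Let $i<k^{\mathsf{u}}$ be such that $i$ does not have a free relation, and let $\iota_i:1\to k^{\mathsf{u}}$ be the map $\iota_i(0)=i$. Then $|P(\iota_i)|\ge 2$.
   Context: Setting: finite relational language $\mathcal{L}=\{U_i:i<k^{\mathsf{u}}\}\cup\{R_i:i<k\}$ with conventions: each vertex satisfies exactly one $U_i$ ($U(a)=i$); $R_i(a,a)$ never; distinct $a,b$ satisfy exactly one $R_i(a,b)$ ($R(a,b)=i$); an involution $\mathrm{Flip}$ of $k$ fixing $0$ with $R_i(a,b)\iff R_{\mathrm{Flip}(i)}(b,a)$; $R=0$ means no relation. $\mathcal{F}$ a finite set of finite irreducible structures (irreducible: $R(a,b)\neq0$ for distinct $a,b$), $\mathcal{K}=\mathrm{Forb}(\mathcal{F})$. Standing assumption: every $i<k^{\mathsf{u}}$ is non-degenerate, i.e. some two-element structure in $\mathcal{K}$ has a vertex of unary $i$ and a nonzero relation between its vertices. $\mathbf{K}$ is a fixed enumerated left-dense Fra\"iss\'e limit of $\mathcal{K}$ (underlying set $\omega$; $\mathbf{K}_n$ induced on $\{0,\dots,n-1\}$; left dense: for every enumerated $\mathbf{B}\in\mathcal{K}$ with $|\mathbf{B}|=m+1$, $\mathbf{B}_m=\mathbf{K}_m$, there is an order-preserving embedding fixing $\{0,\dots,m-1\}$ with $R(f(m),r)=0$ for $m\le r<f(m)$). $T=k^{\mathsf{u}}\times k^{<\omega}$, levels $T(n)$, $\preceq_{lex}$; coding map $c(n)\in T(n)$, $c(n)^{\mathsf{u}}=U(n)$, $c(n)^{\mathsf{b}}(m)=R(n,m)$;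 $\mathrm{CT}(n)$ = restrictions to level $n$ of coding nodes. $\mathcal{L}_d$-structures: binary symbols plus unaries $V_0,\dots,V_{d-1}$ partitioning vertices. For $S=\{s_0\prec_{lex}\dots\prec_{lex}s_{d-1}\}\subseteq T(n)$, $\mathbf{B}[S]$ is the $\mathcal{L}$-structure on $\{0,\dots,n-1\}\cup B$ equal to $\mathbf{K}_n$ there, binary part of $\mathbf{B}$ on $B$, $U(b)=s_{V(b)}^{\mathsf{u}}$, $R(b,x)=s_{V(b)}^{\mathsf{b}}(x)$; $\mathcal{K}(S)=\{\mathbf{B}:\mathbf{B}[S]\in\mathcal{K}\}$; $P(\rho)=\{\mathcal{K}(S):S\subseteq\mathrm{CT}(n)\text{ some }n,\ (s_j^{\mathsf{u}})_{j<d}=\rho\}$. For an $\mathcal{L}_1$-structure $\mathbf{B}$, $q<k$, $j<k^{\mathsf{u}}$: $\mathbf{B}\langle i,q,j\rangle$ is the $\mathcal{L}$-structure on $B\cup\{0\}$ with binary part of $\mathbf{B}$ on $B$, $U(b)=i$ on $B$, $U(0)=j$, $R(b,0)=q$; $\mathcal{K}(\emptyset_i)$ is the class of $\mathcal{L}_1$-structures whose version with all unaries equal to $i$ lies in $\mathcal{K}$. $(q,j)$ with $q>0$ is a free relation for $i$ if $\{\mathbf{B}:\mathbf{B}\langle i,q,j\rangle\in\mathcal{K}\}=\mathcal{K}(\emptyset_i)$. -}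

module Defs where

open import Data.Nat using (ℕ; zero; suc; _+_; _≤_)
open import Data.Fin using (Fin; toℕ; splitAt)
import Data.Fin as F
open import Data.Sum using (_⊎_; inj₁; inj₂)
open import Data.Product using (Σ; Σ-syntax; ∃; ∃-syntax; _×_; _,_)
open import Data.List using (List)
open import Data.List.Relation.Unary.All using (All)
open import Relation.Binary.PropositionalEquality using (_≡_; _≢_)
open import Relation.Nullary using (¬_)
open import Function.Definitions using (Injective)

-- The finite relational language: k^u unary symbols and k = suc k' binary
-- symbols (index 0 = "no relation"), with the involution Flip fixing 0.
record Lang : Set where
  field
    ku    : ℕ
    k'    : ℕ
    Flip  : Fin (suc k') → Fin (suc k')
    Flip-invol : ∀ x → Flip (Flip x) ≡ x
    Flip-zero  : Flip F.zero ≡ F.zero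

module _ (L : Lang) where
  open Lang L

  k : ℕ
  k = suc k'

  record Str (n : ℕ) : Set where
    constructor mkStr
    field
      U : Fin n → Fin ku
      R : Fin n → Fin n → Fin k

  ValidStr : {n : ℕ} → Str n → Set
  ValidStr A = (∀ a → Str.R A a a ≡ F.zero) × (∀ a b → Str.R A b a ≡ Flip (Str.R A a b))

  IsEmbedding : {m n : ℕ} → Str m → Str n → (Fin m → Fin n) → Set
  IsEmbedding A B f = Injective _≡_ _≡_ f
    × (∀ a → Str.U B (f a) ≡ Str.U A a)
    × (∀ a b → Str.R B (f a) (f b) ≡ Str.R A a b)

  Embeds : {m n : ℕ} → Str m → Str n → Set
  Embeds A B = Σ[ f ∈ (Fin _ → Fin _) ] IsEmbedding A B f

  FinStr : Set
  FinStr = Σ[ m ∈ ℕ ] Str m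

  Irreducible : FinStr → Set
  Irreducible (m , A) = ∀ (a b : Fin m) → a ≢ b → Str.R A a b ≢ F.zero

  InK : List FinStr → {n : ℕ} → Str n → Set
  InK ℱ B = ValidStr B × All (λ { (m , A) → ¬ Embeds A B }) ℱ

  -- L_1-structures: only the binary part matters (every vertex satisfies V_0)
  record BStr (n : ℕ) : Set where
    constructor mkBStr
    field
      R : Fin n → Fin n → Fin k

  allU : {n : ℕ} → Fin ku → BStr n → Str n
  allU i B = mkStr (λ _ → i) (BStr.R B)

  -- B⟨i,q,j⟩ : new vertex (called 0, here F.zero), B shifted by one
  angle : {n : ℕ} → BStr n → Fin ku → Fin k → Fin ku → Str (suc n)
  angle {n} B i q j = mkStr U' R'
    where
    U' : Fin (suc n) → Fin ku
    U' F.zero = j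
    U' (F.suc _) = i
    R' : Fin (suc n) → Fin (suc n) → Fin k
    R' F.zero F.zero = F.zero
    R' F.zero (F.suc _) = Flip q
    R' (F.suc _) F.zero = q
    R' (F.suc a) (F.suc b) = BStr.R B a b

  FreeRelation : List FinStr → Fin ku → Fin k → Fin ku → Set
  FreeRelation ℱ i q j = q ≢ F.zero ×
    (∀ (n : ℕ) (B : BStr n) →
      (InK ℱ (angle B i q j) → InK ℱ (allU i B)) × (InK ℱ (allU i B) → InK ℱ (angle B i q j)))

  HasFreeRelation : List FinStr → Fin ku → Set
  HasFreeRelation ℱ i = Σ[ q ∈ Fin k ] Σ[ j ∈ Fin ku ] FreeRelation ℱ i q j

  NonDegenerate : List FinStr → Fin ku → Set
  NonDegenerate ℱ i = Σ[ A ∈ Str 2 ] InK ℱ A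
    × (Str.U A F.zero ≡ i ⊎ Str.U A (F.suc F.zero) ≡ i)
    × Str.R A F.zero (F.suc F.zero) ≢ F.zero

  record CStr : Set where
    constructor mkCStr
    field
      U : ℕ → Fin ku
      R : ℕ → ℕ → Fin k

  ValidCStr : CStr → Set
  ValidCStr K = (∀ a → CStr.R K a a ≡ F.zero) × (∀ a b → CStr.R K b a ≡ Flip (CStr.R K a b))

  induced : (K : CStr) {n : ℕ} → (Fin n → ℕ) → Str n
  induced K a = mkStr (λ x → CStr.U K (a x)) (λ x y → CStr.R K (a x) (a y))

  initial : CStr → (n : ℕ) → Str n
  initial K n = induced K toℕ

  IsAutomorphism : CStr → (ℕ → ℕ) → (ℕ → ℕ) → Set
  IsAutomorphism K σ τ = (∀ x → τ (σ x) ≡ x) × (∀ x → σ (τ x) ≡ x)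
    × (∀ x → CStr.U K (σ x) ≡ CStr.U K x)
    × (∀ x y → CStr.R K (σ x) (σ y) ≡ CStr.R K x y)

  -- K is a Fraïssé limit of Forb(ℱ): age(K) = Forb(ℱ) and K is ultrahomogeneous
  IsFraisseLimit : List FinStr → CStr → Set
  IsFraisseLimit ℱ K = ValidCStr K
    × (∀ (n : ℕ) (a : Fin n → ℕ) → Injective _≡_ _≡_ a → InK ℱ (induced K a))
    × (∀ (n : ℕ) (A : Str n) → InK ℱ A →
         Σ[ a ∈ (Fin n → ℕ) ] Injective _≡_ _≡_ a
           × (∀ x → CStr.U K (a x) ≡ Str.U A x)
           × (∀ x y → CStr.R K (a x) (a y) ≡ Str.R A x y))
    × (∀ (n : ℕ) (a b : Fin n → ℕ) → Injective _≡_ _≡_ a → Injective _≡_ _≡_ b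
         → (∀ x → CStr.U K (a x) ≡ CStr.U K (b x))
         → (∀ x y → CStr.R K (a x) (a y) ≡ CStr.R K (b x) (b y))
         → Σ[ σ ∈ (ℕ → ℕ) ] Σ[ τ ∈ (ℕ → ℕ) ] IsAutomorphism K σ τ × (∀ x → σ (a x) ≡ b x))

  -- left density.  B : Str (suc m) with B_m = K_m; the order-preserving
  -- embedding fixing {0,…,m-1} is determined by the image p of m (with m ≤ p).
  LeftDense : List FinStr → CStr → Set
  LeftDense ℱ K = ∀ (m : ℕ) (B : Str (suc m)) → InK ℱ B
    → (∀ x → Str.U B (F.inject₁ x) ≡ CStr.U K (toℕ x))
    → (∀ x y → Str.R B (F.inject₁ x) (F.inject₁ y) ≡ CStr.R K (toℕ x) (toℕ y))
    → Σ[ p ∈ ℕ ] m ≤ p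
        × CStr.U K p ≡ Str.U B (F.fromℕ m)
        × (∀ x → CStr.R K p (toℕ x) ≡ Str.R B (F.fromℕ m) (F.inject₁ x))
        × (∀ x → CStr.R K (toℕ x) p ≡ Str.R B (F.inject₁ x) (F.fromℕ m))
        × (∀ r → m ≤ r → r Data.Nat.< p → CStr.R K p r ≡ F.zero)

  -- nodes of level n of T = k^u × k^{<ω}
  Node : ℕ → Set
  Node n = Fin ku × (Fin n → Fin k)

  -- c(m) restricted to level n (for n ≤ m this is an element of CT(n))
  codeRestr : CStr → (n m : ℕ) → Node n
  codeRestr K n m = CStr.U K m , (λ x → CStr.R K m (toℕ x))

  -- B[{s}] for s ∈ T(n) (d = 1): K_n on {0,…,n-1}, B on the remaining vertices
  plug : CStr → (n : ℕ) → Node n → {b : ℕ} → BStr b → Str (n + b)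
  plug K n (su , sb) {b} B = mkStr U' R'
    where
    U' : Fin (n + b) → Fin ku
    U' x with splitAt n x
    ... | inj₁ x' = CStr.U K (toℕ x')
    ... | inj₂ _  = su
    R' : Fin (n + b) → Fin (n + b) → Fin k
    R' x y with splitAt n x | splitAt n y
    ... | inj₁ x' | inj₁ y' = CStr.R K (toℕ x') (toℕ y')
    ... | inj₂ _  | inj₁ y' = sb y'
    ... | inj₁ x' | inj₂ _  = Flip (sb x')
    ... | inj₂ x' | inj₂ y' = BStr.R B x' y'

  InKS : List FinStr → CStr → (n : ℕ) → Node n → {b : ℕ} → BStr b → Set
  InKS ℱ K n s B = InK ℱ (plug K n s B)

  -- |P(ι_i)| ≥ 2 : two singletons S₁ ⊆ CT(n₁), S₂ ⊆ CT(n₂) with unary i whose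
  -- classes 𝒦(S₁), 𝒦(S₂) differ (some B lies in one but not in the other)
  PAtLeastTwo : List FinStr → CStr → Fin ku → Set
  PAtLeastTwo ℱ K i =
    Σ[ n₁ ∈ ℕ ] Σ[ m₁ ∈ ℕ ] Σ[ n₂ ∈ ℕ ] Σ[ m₂ ∈ ℕ ]
      n₁ ≤ m₁ × n₂ ≤ m₂ × CStr.U K m₁ ≡ i × CStr.U K m₂ ≡ i
      × Σ[ b ∈ ℕ ] Σ[ B ∈ BStr b ]
          InKS ℱ K n₁ (codeRestr K n₁ m₁) B × ¬ InKS ℱ K n₂ (codeRestr K n₂ m₂) B

-- Non-degeneracy gives an edge (a, b) of K with U(a) = i and q = R(a, b) ≠ 0, and left density
-- yields a vertex p > b of the same type as a over b.  Since (q, U(b)) is not free for i, some B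
-- lies in 𝒦(∅ᵢ) while B⟨i,q,U(b)⟩ does not.  Such a B can be found by a finite search: a forbidden
-- structure embedded into B⟨i,q,j⟩ must meet the apex (otherwise it would embed into B), and deleting
-- the preimage of the apex gives a separating structure.  Then B ∈ 𝒦(c(a)↾0), whereas B[c(p)↾(b+1)]
-- contains a copy of B⟨i,q,U(b)⟩ on b and the new vertices, so B ∉ 𝒦(c(p)↾(b+1)).

module Submission where

open import Defs
open import Data.Empty using (⊥; ⊥-elim)
open import Data.Fin using (Fin; toℕ; fromℕ; inject₁; punchIn; punchOut; join; splitAt)
import Data.Fin as F
open import Data.Fin.Permutation using (Permutation; _⟨$⟩ʳ_; _⟨$⟩ˡ_; inverseˡ; inverseʳ)
import Data.Fin.Permutation as Perm
open import Data.Fin.Properties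
  using ( any?; all?; suc-injective; punchInᵢ≢i; punchIn-punchOut; splitAt-join
        ; toℕ-fromℕ; toℕ-inject₁; toℕ-inject₁-≢; toℕ-injective)
open import Data.List using (List)
open import Data.List.Membership.Propositional using (_∈_)
open import Data.List.Relation.Unary.All as All using (All)
import Data.List.Relation.Unary.Any as Any
open import Data.Nat using (ℕ; zero; suc; _+_; _≤_; z≤n)
import Data.Nat.Properties as ℕ
open import Data.Product using (Σ-syntax; ∃; _×_; _,_; proj₁; proj₂)
open import Data.Sum using (_⊎_; inj₁; inj₂)
open import Data.Sum.Properties using (inj₂-injective)
open import Data.Vec.Functional using (_∷_; head; tail)
open import Function using (_∘_)
open import Function.Definitions using (Injective)
open import Relation.Binary.PropositionalEquality
  using (_≡_; _≢_; refl; sym; trans; cong; cong₂; subst; module ≡-Reasoning)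
open import Relation.Nullary using (¬_; Dec; yes; no; ¬?)
open import Relation.Nullary.Decidable using (_×-dec_; _⊎-dec_; _→-dec_; map′)

module _ (L : Lang) where
  open Lang L

  IsEmbedding-∘ : ∀ {l m n} {A : Str L l} {B : Str L m} {C : Str L n} {g f}
    → IsEmbedding L B C g → IsEmbedding L A B f → IsEmbedding L A C (g ∘ f)
  IsEmbedding-∘ {f = f} (g-inj , gU , gR) (f-inj , fU , fR) =
    f-inj ∘ g-inj ,
    (λ a → trans (gU (f a)) (fU a)) ,
    (λ a b → trans (gR (f a) (f b)) (fR a b))

  IsEmbedding-inverse : ∀ {m n} {A : Str L n} {C : Str L m} (π : Permutation m n)
    → IsEmbedding L A C (π ⟨$⟩ˡ_) → IsEmbedding L C A (π ⟨$⟩ʳ_)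
  IsEmbedding-inverse {C = C} π (_ , fU , fR) =
    (λ e → trans (sym (inverseˡ π)) (trans (cong (π ⟨$⟩ˡ_) e) (inverseˡ π))) ,
    (λ x → trans (sym (fU (π ⟨$⟩ʳ x))) (cong (Str.U C) (inverseˡ π))) ,
    (λ x y → trans (sym (fR (π ⟨$⟩ʳ x) (π ⟨$⟩ʳ y))) (cong₂ (Str.R C) (inverseˡ π) (inverseˡ π)))

  InK-hereditary : ∀ ℱ {m n} {A : Str L m} {C : Str L n} → Embeds L A C → InK L ℱ C → InK L ℱ A
  InK-hereditary ℱ {C = C} (f , emb@(_ , _ , fR)) ((C-irrefl , C-flip) , C-forb) =
    ((λ a → trans (sym (fR a a)) (C-irrefl (f a))) ,
     (λ a b → trans (sym (fR b a)) (trans (C-flip (f a) (f b)) (cong Flip (fR a b))))) ,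
    All.map (λ ¬G↪C (g , G↪A) → ¬G↪C (f ∘ g , IsEmbedding-∘ {C = C} emb G↪A)) C-forb

  -- Without function extensionality the searched property has to respect pointwise equality.
  ∃-function? : ∀ m {n} {P : (Fin m → Fin n) → Set}
    → (∀ f → Dec (P f)) → (∀ {f g} → (∀ x → f x ≡ g x) → P f → P g) → Dec (∃ P)
  ∃-function? zero P? respects with P? (λ ())
  ... | yes p = yes (_ , p)
  ... | no ¬p = no λ (f , pf) → ¬p (respects (λ ()) pf)
  ∃-function? (suc m) P? respects
    with any? (λ a → ∃-function? m (λ g → P? (a ∷ g)) λ e → respects λ { F.zero → refl ; (F.suc x) → e x })
  ... | yes (a , g , p) = yes (a ∷ g , p)
  ... | no ¬p = no λ (f , pf) → ¬p (head f , tail f , respects (λ { F.zero → refl ; (F.suc x) → refl }) pf)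

  Embeds? : ∀ {m n} (A : Str L m) (C : Str L n) → Dec (Embeds L A C)
  Embeds? {m} A C = ∃-function? m isEmbedding? respects
    where
    isEmbedding? : ∀ f → Dec (IsEmbedding L A C f)
    isEmbedding? f =
      map′ (λ h {x} {y} → h x y) (λ h x y → h)
        (all? λ x → all? λ y → (f x F.≟ f y) →-dec (x F.≟ y))
      ×-dec (all? λ a → Str.U C (f a) F.≟ Str.U A a)
      ×-dec (all? λ a → all? λ b → Str.R C (f a) (f b) F.≟ Str.R A a b)
    respects : ∀ {f g} → (∀ x → f x ≡ g x) → IsEmbedding L A C f → IsEmbedding L A C g
    respects {f} {g} f≗g (f-inj , fU , fR) =
      (λ {x} {y} e → f-inj (trans (f≗g x) (trans e (sym (f≗g y))))) ,
      (λ a → trans (cong (Str.U C) (sym (f≗g a))) (fU a)) ,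
      (λ a b → trans (cong₂ (Str.R C) (sym (f≗g a)) (sym (f≗g b))) (fR a b))

  InK? : ∀ ℱ {n} (B : Str L n) → Dec (InK L ℱ B)
  InK? ℱ B =
    ((all? λ a → Str.R B a a F.≟ F.zero) ×-dec
     (all? λ a → all? λ b → Str.R B b a F.≟ Flip (Str.R B a b)))
    ×-dec All.all? (λ { (m , A) → ¬? (Embeds? A B) }) ℱ

  deleteVertex : ∀ {m} → Str L (suc m) → Fin (suc m) → BStr L m
  deleteVertex G w = mkBStr λ x y → Str.R G (punchIn w x) (punchIn w y)

  Flip-reflects-zero : ∀ {r} → Flip r ≡ F.zero → r ≡ F.zero
  Flip-reflects-zero {r} e = trans (sym (Flip-invol r)) (trans (cong Flip e) Flip-zero)

  module Apex (ℱ : List (FinStr L)) (i : Fin ku) (q : Fin (k L)) (j : Fin ku) where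

    Separates : ∀ {n} → BStr L n → Set
    Separates B = InK L ℱ (allU L i B) × ¬ InK L ℱ (angle L B i q j)

    HasSeparatingDeletion : FinStr L → Set
    HasSeparatingDeletion (zero , G) = ⊥
    HasSeparatingDeletion (suc m , G) = Σ[ w ∈ Fin (suc m) ] Separates (deleteVertex G w)

    hasSeparatingDeletion? : ∀ G → Dec (HasSeparatingDeletion G)
    hasSeparatingDeletion? (zero , G) = no λ ()
    hasSeparatingDeletion? (suc m , G) = any? λ w →
      InK? ℱ (allU L i (deleteVertex G w)) ×-dec ¬? (InK? ℱ (angle L (deleteVertex G w) i q j))

    suc-isEmbedding : ∀ {n} {B : BStr L n} → IsEmbedding L (allU L i B) (angle L B i q j) F.suc
    suc-isEmbedding = suc-injective , (λ _ → refl) , (λ _ _ → refl)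

    angle-valid : ∀ {n} {B : BStr L n} → ValidStr L (allU L i B) → ValidStr L (angle L B i q j)
    angle-valid {B = B} (B-irrefl , B-flip) = irrefl , flip
      where
      irrefl : ∀ a → Str.R (angle L B i q j) a a ≡ F.zero
      irrefl F.zero = refl
      irrefl (F.suc a) = B-irrefl a
      flip : ∀ a b → Str.R (angle L B i q j) b a ≡ Flip (Str.R (angle L B i q j) a b)
      flip F.zero F.zero = sym Flip-zero
      flip F.zero (F.suc b) = sym (Flip-invol q)
      flip (F.suc a) F.zero = refl
      flip (F.suc a) (F.suc b) = B-flip a b

    module _ {n} {B : BStr L n} where
      private
        A⁺ : Str L (suc n)
        A⁺ = angle L B i q j

      U-off-apex : ∀ {y} → F.zero ≢ y → Str.U A⁺ y ≡ i
      U-off-apex {F.zero} y≢0 = ⊥-elim (y≢0 refl)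
      U-off-apex {F.suc _} _ = refl

      R-to-apex : ∀ {y} → F.zero ≢ y → Str.R A⁺ y F.zero ≡ q
      R-to-apex {F.zero} y≢0 = ⊥-elim (y≢0 refl)
      R-to-apex {F.suc _} _ = refl

      R-from-apex : ∀ {y} → F.zero ≢ y → Str.R A⁺ F.zero y ≡ Flip q
      R-from-apex {F.zero} y≢0 = ⊥-elim (y≢0 refl)
      R-from-apex {F.suc _} _ = refl

      avoidApex-isEmbedding : ∀ {m} {A : Str L m} {f} → IsEmbedding L A A⁺ f
        → (off : ∀ x → F.zero ≢ f x) → IsEmbedding L A (allU L i B) (λ x → punchOut (off x))
      avoidApex-isEmbedding {f = f} (f-inj , fU , fR) off =
        (λ {x} {y} e → f-inj (trans (sym (lift x)) (trans (cong F.suc e) (lift y)))) ,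
        (λ x → trans (cong (Str.U A⁺) (lift x)) (fU x)) ,
        (λ x y → trans (cong₂ (Str.R A⁺) (lift x) (lift y)) (fR x y))
        where
        lift : ∀ x → F.suc (punchOut (off x)) ≡ f x
        lift x = punchIn-punchOut (off x)

      module _ {m} {G : Str L (suc m)} {f} (emb : IsEmbedding L G A⁺ f) {w} (fw≡0 : f w ≡ F.zero) where
        private
          f-inj : Injective _≡_ _≡_ f
          f-inj = proj₁ emb
          fU : ∀ x → Str.U A⁺ (f x) ≡ Str.U G x
          fU = proj₁ (proj₂ emb)
          fR : ∀ x y → Str.R A⁺ (f x) (f y) ≡ Str.R G x y
          fR = proj₂ (proj₂ emb)
          D : BStr L m
          D = deleteVertex G w

        off-apex : ∀ x → F.zero ≢ f (punchIn w x)
        off-apex x e = punchInᵢ≢i w x (f-inj (trans (sym e) (sym fw≡0)))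

        moveApex : Permutation (suc m) (suc m)
        moveApex = Perm.insert w F.zero Perm.id

        -- moveApex ⟨$⟩ˡ_ sends the apex to w and suc x to punchIn w x
        restoreApex-isEmbedding : IsEmbedding L (angle L D i q j) G (moveApex ⟨$⟩ˡ_)
        restoreApex-isEmbedding =
          (λ e → trans (sym (inverseʳ moveApex)) (trans (cong (moveApex ⟨$⟩ʳ_) e) (inverseʳ moveApex))) ,
          U , R
          where
          U : ∀ x → Str.U G (moveApex ⟨$⟩ˡ x) ≡ Str.U (angle L D i q j) x
          U F.zero = trans (sym (fU w)) (cong (Str.U A⁺) fw≡0)
          U (F.suc x) = trans (sym (fU (punchIn w x))) (U-off-apex (off-apex x))
          R : ∀ x y → Str.R G (moveApex ⟨$⟩ˡ x) (moveApex ⟨$⟩ˡ y) ≡ Str.R (angle L D i q j) x y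
          R F.zero F.zero = trans (sym (fR w w)) (cong₂ (Str.R A⁺) fw≡0 fw≡0)
          R F.zero (F.suc y) =
            trans (sym (fR w (punchIn w y)))
              (trans (cong (λ u → Str.R A⁺ u (f (punchIn w y))) fw≡0) (R-from-apex (off-apex y)))
          R (F.suc x) F.zero =
            trans (sym (fR (punchIn w x) w))
              (trans (cong (Str.R A⁺ (f (punchIn w x))) fw≡0) (R-to-apex (off-apex x)))
          R (F.suc x) (F.suc y) = refl

    separatingDeletion : ∀ {n} {B : BStr L n} {m} {G : Str L m} → (m , G) ∈ ℱ
      → InK L ℱ (allU L i B) → Embeds L G (angle L B i q j) → HasSeparatingDeletion (m , G)
    separatingDeletion mem inB (f , emb) with any? (λ w → f w F.≟ F.zero)
    ... | no none = ⊥-elim (All.lookup (proj₂ inB) mem (_ , avoidApex-isEmbedding emb λ x e → none (x , sym e)))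
    separatingDeletion {m = zero} mem inB (f , emb) | yes (() , _)
    separatingDeletion {B = B} {m = suc m} {G = G} mem inB (f , emb) | yes (w , fw≡0) =
      w ,
      InK-hereditary ℱ (_ , avoidApex-isEmbedding D↪B⁺ (off-apex emb fw≡0)) inB ,
      λ inD → All.lookup (proj₂ inD) mem
        (_ , IsEmbedding-inverse (moveApex emb fw≡0) (restoreApex-isEmbedding emb fw≡0))
      where
      D↪B⁺ : IsEmbedding L (allU L i (deleteVertex G w)) (angle L B i q j) (f ∘ punchIn w)
      D↪B⁺ = IsEmbedding-∘ {C = angle L B i q j} emb
        (IsEmbedding-∘ {B = angle L (deleteVertex G w) i q j} {C = G} (restoreApex-isEmbedding emb fw≡0) suc-isEmbedding)

    nonFree⇒separating : q ≢ F.zero → ¬ FreeRelation L ℱ i q j → Σ[ b ∈ ℕ ] Σ[ B ∈ BStr L b ] Separates B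
    nonFree⇒separating q≢0 ¬free with Any.any? hasSeparatingDeletion? ℱ
    ... | yes hit with Any.satisfied hit
    ...   | (zero , G) , ()
    ...   | (suc m , G) , w , sep = m , deleteVertex G w , sep
    nonFree⇒separating q≢0 ¬free | no miss =
      ⊥-elim (¬free (q≢0 , λ n B → InK-hereditary ℱ {C = angle L B i q j} (_ , suc-isEmbedding) , addApex))
      where
      addApex : ∀ {n} {B : BStr L n} → InK L ℱ (allU L i B) → InK L ℱ (angle L B i q j)
      addApex inB = angle-valid (proj₁ inB) ,
        All.tabulate λ mem emb → miss (Any.map (λ { refl → separatingDeletion mem inB emb }) mem)

  module _ (ℱ : List (FinStr L)) (K : CStr L) (fr : IsFraisseLimit L ℱ K) where
    private
      UK : ℕ → Fin ku
      UK = CStr.U K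
      RK : ℕ → ℕ → Fin (k L)
      RK = CStr.R K

    RK-irrefl : ∀ a → RK a a ≡ F.zero
    RK-irrefl = proj₁ (proj₁ fr)

    RK-flip : ∀ a b → RK b a ≡ Flip (RK a b)
    RK-flip = proj₂ (proj₁ fr)

    forbidden-not-in-K : ∀ {m} {G : Str L m} → (m , G) ∈ ℱ → (g : Fin m → ℕ) → Injective _≡_ _≡_ g
      → (∀ a → UK (g a) ≡ Str.U G a) → (∀ a b → RK (g a) (g b) ≡ Str.R G a b) → ⊥
    forbidden-not-in-K mem g g-inj gU gR =
      All.lookup (proj₂ (proj₁ (proj₂ fr) _ g g-inj)) mem ((λ a → a) , (λ e → e) , gU , gR)

    nonDegenerate⇒edge : ∀ {i} → NonDegenerate L ℱ i → Σ[ a ∈ ℕ ] Σ[ b ∈ ℕ ] UK a ≡ i × RK a b ≢ F.zero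
    nonDegenerate⇒edge (A , inA , side , R01≢0) with proj₁ (proj₂ (proj₂ fr)) 2 A inA
    ... | e , _ , eU , eR with side
    ... | inj₁ U0≡i = e F.zero , e (F.suc F.zero) , trans (eU F.zero) U0≡i ,
          λ r≡0 → R01≢0 (trans (sym (eR F.zero (F.suc F.zero))) r≡0)
    ... | inj₂ U1≡i = e (F.suc F.zero) , e F.zero , trans (eU (F.suc F.zero)) U1≡i ,
          λ r≡0 → R01≢0 (Flip-reflects-zero (trans (sym R10≡FlipR01) r≡0))
      where
      R10≡FlipR01 : RK (e (F.suc F.zero)) (e F.zero) ≡ Flip (Str.R A F.zero (F.suc F.zero))
      R10≡FlipR01 = trans (eR (F.suc F.zero) F.zero) (proj₂ (proj₁ inA) F.zero (F.suc F.zero))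

    angle-embeds-plug : ∀ n (s : Node L n) (v : Fin n) {c} (B : BStr L c) {i q j}
      → proj₁ s ≡ i → proj₂ s v ≡ q → UK (toℕ v) ≡ j → Embeds L (angle L B i q j) (plug L K n s B)
    angle-embeds-plug n s v {c} B refl refl refl = join n c ∘ place , place-inj , U , R
      where
      A⁺ : Str L (suc c)
      A⁺ = angle L B (proj₁ s) (proj₂ s v) (UK (toℕ v))
      P : Str L (n + c)
      P = plug L K n s B
      place : Fin (suc c) → Fin n ⊎ Fin c
      place F.zero = inj₁ v
      place (F.suc y) = inj₂ y
      place-inj : ∀ {x y} → join n c (place x) ≡ join n c (place y) → x ≡ y
      place-inj {x} {y} e
        with trans (sym (splitAt-join n c (place x))) (trans (cong (splitAt n) e) (splitAt-join n c (place y)))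
      place-inj {F.zero} {F.zero} _ | _ = refl
      place-inj {F.suc x} {F.suc y} _ | e′ = cong F.suc (inj₂-injective e′)
      place-inj {F.zero} {F.suc y} _ | ()
      place-inj {F.suc x} {F.zero} _ | ()
      U : ∀ x → Str.U P (join n c (place x)) ≡ Str.U A⁺ x
      U F.zero rewrite splitAt-join n c (inj₁ v) = refl
      U (F.suc y) rewrite splitAt-join n c (inj₂ {A = Fin n} y) = refl
      R : ∀ x y → Str.R P (join n c (place x)) (join n c (place y)) ≡ Str.R A⁺ x y
      R F.zero F.zero rewrite splitAt-join n c (inj₁ v) = RK-irrefl (toℕ v)
      R F.zero (F.suc y) rewrite splitAt-join n c (inj₁ v) | splitAt-join n c (inj₂ {A = Fin n} y) = refl
      R (F.suc x) F.zero rewrite splitAt-join n c (inj₁ v) | splitAt-join n c (inj₂ {A = Fin n} x) = refl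
      R (F.suc x) (F.suc y)
        rewrite splitAt-join n c (inj₂ {A = Fin n} x) | splitAt-join n c (inj₂ {A = Fin n} y) = refl

    -- K_{b+1} together with a new vertex b+1 that copies a but is related only to b
    module CopyEdge (a b : ℕ) (Rab≢0 : RK a b ≢ F.zero) where
      a≢b : a ≢ b
      a≢b refl = Rab≢0 (RK-irrefl a)

      new : ℕ
      new = suc b

      shadow : ℕ → ℕ
      shadow x with x ℕ.≟ new
      ... | yes _ = a
      ... | no _ = x

      shadow-new : shadow new ≡ a
      shadow-new with new ℕ.≟ new
      ... | yes _ = refl
      ... | no new≢new = ⊥-elim (new≢new refl)

      shadow-old : ∀ {x} → x ≢ new → shadow x ≡ x
      shadow-old {x} x≢new with x ℕ.≟ new
      ... | yes x≡new = ⊥-elim (x≢new x≡new)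
      ... | no _ = refl

      Linked : ℕ → ℕ → Set
      Linked x y = x ≡ y ⊎ (x ≢ new × y ≢ new) ⊎ (x ≡ new × y ≡ b) ⊎ (x ≡ b × y ≡ new)

      linked? : ∀ x y → Dec (Linked x y)
      linked? x y = x ℕ.≟ y ⊎-dec (¬? (x ℕ.≟ new) ×-dec ¬? (y ℕ.≟ new))
        ⊎-dec (x ℕ.≟ new ×-dec y ℕ.≟ b) ⊎-dec (x ℕ.≟ b ×-dec y ℕ.≟ new)

      Linked-sym : ∀ {x y} → Linked x y → Linked y x
      Linked-sym (inj₁ x≡y) = inj₁ (sym x≡y)
      Linked-sym (inj₂ (inj₁ (x-old , y-old))) = inj₂ (inj₁ (y-old , x-old))
      Linked-sym (inj₂ (inj₂ (inj₁ (x≡new , y≡b)))) = inj₂ (inj₂ (inj₂ (y≡b , x≡new)))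
      Linked-sym (inj₂ (inj₂ (inj₂ (x≡b , y≡new)))) = inj₂ (inj₂ (inj₁ (y≡new , x≡b)))

      R⁺ : ℕ → ℕ → Fin (k L)
      R⁺ x y with linked? x y
      ... | yes _ = RK (shadow x) (shadow y)
      ... | no _ = F.zero

      R⁺-linked : ∀ {x y} → Linked x y → R⁺ x y ≡ RK (shadow x) (shadow y)
      R⁺-linked {x} {y} xy with linked? x y
      ... | yes _ = refl
      ... | no ¬xy = ⊥-elim (¬xy xy)

      R⁺-nonzero : ∀ {x y} → R⁺ x y ≢ F.zero → Linked x y
      R⁺-nonzero {x} {y} r≢0 with linked? x y
      ... | yes xy = xy
      ... | no _ = ⊥-elim (r≢0 refl)

      b≢new : b ≢ new
      b≢new = ℕ.1+n≢n ∘ sym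

      shadow-new≢shadow-b : shadow new ≢ shadow b
      shadow-new≢shadow-b e = a≢b (trans (sym shadow-new) (trans e (shadow-old b≢new)))

      shadow-injective : ∀ {x y} → Linked x y → shadow x ≡ shadow y → x ≡ y
      shadow-injective (inj₁ x≡y) _ = x≡y
      shadow-injective (inj₂ (inj₁ (x-old , y-old))) e = trans (sym (shadow-old x-old)) (trans e (shadow-old y-old))
      shadow-injective (inj₂ (inj₂ (inj₁ (refl , refl)))) e = ⊥-elim (shadow-new≢shadow-b e)
      shadow-injective (inj₂ (inj₂ (inj₂ (refl , refl)))) e = ⊥-elim (shadow-new≢shadow-b (sym e))

      extension : Str L (suc new)
      extension = mkStr (λ x → UK (shadow (toℕ x))) (λ x y → R⁺ (toℕ x) (toℕ y))

      extension-valid : ValidStr L extension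
      extension-valid = (λ x → irrefl (toℕ x)) , (λ x y → flip (toℕ x) (toℕ y))
        where
        irrefl : ∀ x → R⁺ x x ≡ F.zero
        irrefl x = trans (R⁺-linked {x} (inj₁ refl)) (RK-irrefl (shadow x))
        flip : ∀ x y → R⁺ y x ≡ Flip (R⁺ x y)
        flip x y with linked? x y | linked? y x
        ... | yes _ | yes _ = RK-flip (shadow x) (shadow y)
        ... | no _ | no _ = sym Flip-zero
        ... | yes xy | no ¬yx = ⊥-elim (¬yx (Linked-sym xy))
        ... | no ¬xy | yes yx = ⊥-elim (¬xy (Linked-sym yx))

      -- Irreducibility makes any two vertices of an embedded forbidden structure Linked,
      -- and on Linked pairs shadow is injective and preserves R, so it re-embeds the structure into K.
      extension-InK : All (Irreducible L) ℱ → InK L ℱ extension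
      extension-InK irr = extension-valid , All.tabulate forbidden
        where
        forbidden : ∀ {G} → G ∈ ℱ → ¬ Embeds L (proj₂ G) extension
        forbidden {m , G} mem (f , f-inj , fU , fR) = forbidden-not-in-K mem g g-inj fU gR
          where
          linked : ∀ x y → Linked (toℕ (f x)) (toℕ (f y))
          linked x y with x F.≟ y
          ... | yes refl = inj₁ refl
          ... | no x≢y = R⁺-nonzero λ r≡0 → All.lookup irr mem x y x≢y (trans (sym (fR x y)) r≡0)
          g : Fin m → ℕ
          g = shadow ∘ toℕ ∘ f
          g-inj : Injective _≡_ _≡_ g
          g-inj {x} {y} e = f-inj (toℕ-injective (shadow-injective (linked x y) e))
          gR : ∀ x y → RK (g x) (g y) ≡ Str.R G x y
          gR x y = trans (sym (R⁺-linked (linked x y))) (fR x y)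

      inject₁≢new : (x : Fin new) → toℕ (inject₁ x) ≢ new
      inject₁≢new x = toℕ-inject₁-≢ x ∘ sym

      shadow-inject₁ : (x : Fin new) → shadow (toℕ (inject₁ x)) ≡ toℕ x
      shadow-inject₁ x = trans (shadow-old (inject₁≢new x)) (toℕ-inject₁ x)

      extension-U-old : ∀ x → Str.U extension (inject₁ x) ≡ UK (toℕ x)
      extension-U-old x = cong UK (shadow-inject₁ x)

      extension-R-old : ∀ x y → Str.R extension (inject₁ x) (inject₁ y) ≡ RK (toℕ x) (toℕ y)
      extension-R-old x y = trans (R⁺-linked (inj₂ (inj₁ (inject₁≢new x , inject₁≢new y))))
        (cong₂ RK (shadow-inject₁ x) (shadow-inject₁ y))

      copy-above : All (Irreducible L) ℱ → LeftDense L ℱ K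
        → Σ[ p ∈ ℕ ] suc b ≤ p × UK p ≡ UK a × RK p b ≡ RK a b
      copy-above irr ld with ld new extension (extension-InK irr) extension-U-old extension-R-old
      ... | p , new≤p , Up , Rp , _ = p , new≤p , Up≡Ua , Rpb≡Rab
        where
        open ≡-Reasoning
        toℕ-inject₁-fromℕ : toℕ (inject₁ (fromℕ b)) ≡ b
        toℕ-inject₁-fromℕ = trans (toℕ-inject₁ (fromℕ b)) (toℕ-fromℕ b)
        Up≡Ua : UK p ≡ UK a
        Up≡Ua = trans Up (cong UK (trans (cong shadow (toℕ-fromℕ new)) shadow-new))
        Rpb≡Rab : RK p b ≡ RK a b
        Rpb≡Rab = begin
          RK p b                                          ≡⟨ cong (RK p) (sym (toℕ-fromℕ b)) ⟩
          RK p (toℕ (fromℕ b))                            ≡⟨ Rp (fromℕ b) ⟩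
          R⁺ (toℕ (fromℕ new)) (toℕ (inject₁ (fromℕ b)))  ≡⟨ cong₂ R⁺ (toℕ-fromℕ new) toℕ-inject₁-fromℕ ⟩
          R⁺ new b                                        ≡⟨ R⁺-linked (inj₂ (inj₂ (inj₁ (refl , refl)))) ⟩
          RK (shadow new) (shadow b)                      ≡⟨ cong₂ RK shadow-new (shadow-old b≢new) ⟩
          RK a b                                          ∎

lemma4p37 : (L : Lang) (ℱ : List (FinStr L)) → All (Irreducible L) ℱ
    → (∀ (i : Fin (Lang.ku L)) → NonDegenerate L ℱ i)
    → (K : CStr L) → IsFraisseLimit L ℱ K → LeftDense L ℱ K
    → (i : Fin (Lang.ku L)) → ¬ HasFreeRelation L ℱ i
    → PAtLeastTwo L ℱ K i
lemma4p37 L ℱ irr nonDeg K fr ld i ¬free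
  with nonDegenerate⇒edge L ℱ K fr (nonDeg i)
... | a , b , Ua≡i , Rab≢0
  with CopyEdge.copy-above L ℱ K fr a b Rab≢0 irr ld
... | p , b<p , Up≡Ua , Rpb≡Rab
  with Apex.nonFree⇒separating L ℱ i (CStr.R K a b) (CStr.U K b) Rab≢0 (λ free → ¬free (_ , _ , free))
... | c , B , inB , angle∉K =
  0 , a , suc b , p , z≤n , b<p , Ua≡i , trans Up≡Ua Ua≡i , c , B ,
  -- at level 0, B[c(a)↾0] is allU (U a) B on the nose
  subst (λ u → InK L ℱ (allU L u B)) (sym Ua≡i) inB ,
  λ inPlug → angle∉K (InK-hereditary L ℱ {C = plugged} angle↪plug inPlug)
  where
  s : Node L (suc b)
  s = codeRestr L K (suc b) p
  plugged : Str L (suc b + c)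
  plugged = plug L K (suc b) s B
  angle↪plug : Embeds L (angle L B i (CStr.R K a b) (CStr.U K b)) plugged
  angle↪plug = angle-embeds-plug L ℱ K fr (suc b) s (fromℕ b) B
    (trans Up≡Ua Ua≡i) (trans (cong (CStr.R K p) (toℕ-fromℕ b)) Rpb≡Rab) (cong (CStr.U K) (toℕ-fromℕ b))
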